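{- Let $a,b,c$ be positive integers satisfying (iv) $ab+ac+bc+a+b+c+1\ge b(b+1)$, (v) $(a+1)(b+c+1)\ge bc$, and (vi) $b+1\ge c$. If $a\le 4$, then $c\le 11$ and $b\le 18$.
   Context: These inequalities are necessary conditions for $(a,b,c)$ to be the first diagonal of an arithmetic Y-frieze pattern of width $3$. -}

module Defs where

module Submission where

open import Defs
open import Data.Nat using (ℕ; _+_; _*_; _≤_; _<_; _≥_; z<s; _≤?_; _<?_)
open import Data.Nat.Properties
open import Data.Nat.Tactic.RingSolver using (solve-∀)
open import Data.Empty using (⊥)
open import Data.Product using (_×_; _,_)
open import Relation.Binary.PropositionalEquality using (_≡_; refl; sym)
open import Relation.Nullary.Decidable using (from-yes)

-- With a ≤ 4, condition (v) reads bc ≤ 5(b + c + 1), which fails on every quadrant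
-- b ≥ B, c ≥ C with B, C ≥ 5 whose corner (B, C) already violates it. Condition (vi)
-- confines c ≥ 12 to such a quadrant with corner (11, 12), and condition (iv) forces
-- b ≤ c + 2a + 1 ≤ c + 9, confining b ≥ 19 to the quadrant with corner (19, 10).

-- Once the corner violates the inequality, moving away from it only helps:
-- the growth C x + B z + x z of the product beats the growth k x + k z of the bound.
product-exceeds-on-quadrant : ∀ {k B C b c} → k ≤ B → k ≤ C → B ≤ b → C ≤ c →
  k * (B + C + 1) < B * C → k * (b + c + 1) < b * c
product-exceeds-on-quadrant {k} {B} {C} k≤B k≤C B≤b C≤c corner
  with x , refl ← m≤n⇒∃[o]m+o≡n B≤b | z , refl ← m≤n⇒∃[o]m+o≡n C≤c = begin-strict
  k * (B + x + (C + z) + 1)         ≡⟨ expand-bound k B C x z ⟩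
  k * (B + C + 1) + (k * x + k * z) <⟨ +-mono-<-≤ corner
                                         (+-mono-≤ (*-monoˡ-≤ x k≤C) (*-monoˡ-≤ z k≤B)) ⟩
  B * C + (C * x + B * z)           ≤⟨ m≤m+n _ (x * z) ⟩
  B * C + (C * x + B * z) + x * z   ≡⟨ expand-product B C x z ⟩
  (B + x) * (C + z)                 ∎
  where
  open ≤-Reasoning
  expand-bound : ∀ k B C x z → k * (B + x + (C + z) + 1) ≡ k * (B + C + 1) + (k * x + k * z)
  expand-bound = solve-∀
  expand-product : ∀ B C x z → B * C + (C * x + B * z) + x * z ≡ (B + x) * (C + z)
  expand-product = solve-∀

product-bound-excludes-quadrant : ∀ {k B C b c} → k ≤ B → k ≤ C →
  k * (B + C + 1) < B * C → b * c ≤ k * (b + c + 1) → B ≤ b → C ≤ c → ⊥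
product-bound-excludes-quadrant k≤B k≤C corner bc≤ B≤b C≤c =
  <⇒≱ (product-exceeds-on-quadrant k≤B k≤C B≤b C≤c corner) bc≤

square-bound⇒b≤c+2a+1 : ∀ a b c → b * (b + 1) ≤ a * b + a * c + b * c + a + b + c + 1 →
  b ≤ c + (2 * a + 1)
square-bound⇒b≤c+2a+1 a b c iv = ≮⇒≥ λ c+2a+1<b → <⇒≱ (square-exceeds c+2a+1<b) iv
  where
  square-expansion : ∀ a c y → (1 + (c + (2 * a + 1)) + y) * (1 + (c + (2 * a + 1)) + y + 1) ≡
    a * (1 + (c + (2 * a + 1)) + y) + a * c + (1 + (c + (2 * a + 1)) + y) * c + a
      + (1 + (c + (2 * a + 1)) + y) + c + 1
    + (3 + c + c * y + 2 * a * a + 5 * a + 3 * a * y + 4 * y + y * y)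
  square-expansion = solve-∀
  square-exceeds : c + (2 * a + 1) < b → a * b + a * c + b * c + a + b + c + 1 < b * (b + 1)
  square-exceeds c+2a+1<b with y , refl ← m≤n⇒∃[o]m+o≡n c+2a+1<b =
    <-≤-trans (m<m+n _ z<s) (≤-reflexive (sym (square-expansion a c y)))

proposition2p2 : (a b c : ℕ) → 1 ≤ a → 1 ≤ b → 1 ≤ c →
    a * b + a * c + b * c + a + b + c + 1 ≥ b * (b + 1) →
    (a + 1) * (b + c + 1) ≥ b * c →
    b + 1 ≥ c →
    a ≤ 4 →
    c ≤ 11 × b ≤ 18
proposition2p2 a b c _ _ _ iv v vi a≤4 = c≤11 , b≤18
  where
  v₄ : b * c ≤ 5 * (b + c + 1)
  v₄ = ≤-trans v (*-monoˡ-≤ (b + c + 1) (+-monoˡ-≤ 1 a≤4))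
  b≤c+9 : b ≤ c + 9
  b≤c+9 = ≤-trans (square-bound⇒b≤c+2a+1 a b c iv) (+-monoʳ-≤ c (+-monoˡ-≤ 1 (*-monoʳ-≤ 2 a≤4)))
  c≤11 : c ≤ 11
  c≤11 = ≮⇒≥ λ 12≤c → product-bound-excludes-quadrant {B = 11} {C = 12}
    (from-yes (5 ≤? 11)) (from-yes (5 ≤? 12)) (from-yes (5 * (11 + 12 + 1) <? 11 * 12))
    v₄ (+-cancelʳ-≤ 1 11 b (≤-trans 12≤c vi)) 12≤c
  b≤18 : b ≤ 18
  b≤18 = ≮⇒≥ λ 19≤b → product-bound-excludes-quadrant {B = 19} {C = 10}
    (from-yes (5 ≤? 19)) (from-yes (5 ≤? 10)) (from-yes (5 * (19 + 10 + 1) <? 19 * 10))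
    v₄ 19≤b (+-cancelʳ-≤ 9 10 c (≤-trans 19≤b b≤c+9))
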